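{- Let $n$ be a nonnegative integer. Then $|\Phi^+_n|-|\Phi^-_n|=p(\tfrac{n}{2})$.
   Context: A symbol is an ordered pair $\Lambda=\binom{A}{B}$ of finite subsets $A,B$ of nonnegative integers, written $\binom{a_1,\dots,a_{m_1}}{b_1,\dots,b_{m_2}}$ with $a_1>\dots>a_{m_1}$, $b_1>\dots>b_{m_2}$. Its rank is $\mathrm{rk}(\Lambda)=\sum_i a_i+\sum_j b_j-\lfloor((|A|+|B|-1)/2)^2\rfloor$ and its defect is $\mathrm{def}(\Lambda)=|A|-|B|$. Symbols are considered up to the equivalence relation generated by $\binom{a_1,\dots,a_{m_1}}{b_1,\dots,b_{m_2}}\sim\binom{a_1+1,\dots,a_{m_1}+1,0}{b_1+1,\dots,b_{m_2}+1,0}$, which preserves rank and defect; $\Phi_{n,d}$ denotes the set of equivalence classes of symbols of rank $n$ and defect $d$ ($d\in\mathbb{Z}$). Define $\Phi^+_n=\bigcup_{d\equiv 0\pmod 4}\Phi_{n,d}$ and $\Phi^-_n=\bigcup_{d\equiv 2\pmod 4}\Phi_{n,d}$ (unions over all integers $d$, including negative ones). Here $p(m)$ is the number of partitions of $m$, with $p(0)=1$ and $p(x)=0$ if $x$ is not a nonnegative integer. -}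

module Defs where

open import Data.Nat as ℕ using (ℕ; zero; suc; _<_; _>_; _≥_; _^_; _∸_)
import Data.Nat.DivMod as ℕD
open import Data.Integer as ℤ using (ℤ; +_; _-_)
open import Data.Integer.Divisibility using (_∣_)
open import Data.List using (List; []; _∷_; map; length; _++_; [_])
open import Data.Nat.ListAction using (sum)
open import Data.List.Relation.Unary.Linked using (Linked)
open import Data.List.Relation.Unary.All using (All)
open import Data.List.Relation.Unary.Any using (Any)
open import Data.List.Relation.Unary.AllPairs using (AllPairs)
open import Data.List.Membership.Propositional using (_∈_)
open import Data.Product using (_×_; _,_; proj₁; proj₂)
open import Relation.Binary.PropositionalEquality using (_≡_; _≢_)
open import Relation.Binary.Construct.Closure.Equivalence using (EqClosure)
open import Relation.Nullary using (¬_)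

RawSymbol : Set
RawSymbol = List ℕ × List ℕ

-- A symbol: both rows strictly decreasing, i.e. finite subsets of ℕ
-- written as a₁ > … > a_{m₁}, b₁ > … > b_{m₂}.
IsSymbol : RawSymbol → Set
IsSymbol (A , B) = Linked _>_ A × Linked _>_ B

size : RawSymbol → ℕ
size (A , B) = length A ℕ.+ length B

-- rk(Λ) = Σ a_i + Σ b_j - ⌊((|A|+|B|-1)/2)²⌋ ;
-- ⌊((s-1)/2)²⌋ = ⌊(s-1)²/4⌋, and for s = 0 it is ⌊1/4⌋ = 0 = ⌊(0∸1)²/4⌋.
rank : RawSymbol → ℤ
rank (A , B) = + (sum A ℕ.+ sum B) - + (((size (A , B) ∸ 1) ^ 2) ℕD./ 4)

defect : RawSymbol → ℤ
defect (A , B) = + length A - + length B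

shift : RawSymbol → RawSymbol
shift (A , B) = (map suc A ++ [ 0 ]) , (map suc B ++ [ 0 ])

ShiftStep : RawSymbol → RawSymbol → Set
ShiftStep Λ Λ' = Λ' ≡ shift Λ

_∼_ : RawSymbol → RawSymbol → Set
_∼_ = EqClosure ShiftStep

InPhiPlus : ℕ → RawSymbol → Set
InPhiPlus n Λ = rank Λ ≡ + n × (+ 4) ∣ defect Λ

InPhiMinus : ℕ → RawSymbol → Set
InPhiMinus n Λ = rank Λ ≡ + n × (+ 4) ∣ (defect Λ - + 2)

-- L is a complete list of representatives of the equivalence classes
-- of symbols satisfying P (one per class); hence length L = number of classes.
EnumeratesClasses : (RawSymbol → Set) → List RawSymbol → Set
EnumeratesClasses P L =
  All (λ Λ → IsSymbol Λ × P Λ) L ×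
  AllPairs (λ Λ Λ' → ¬ (Λ ∼ Λ')) L ×
  (∀ Λ → IsSymbol Λ → P Λ → Any (λ Λ' → Λ ∼ Λ') L)

IsPartition : List ℕ → Set
IsPartition λs = Linked _≥_ λs × All (0 <_) λs

-- λ is a partition of n/2 (there are none when n is odd, so p(n/2)=0 then)
IsPartitionOfHalf : ℕ → List ℕ → Set
IsPartitionOfHalf n λs = IsPartition λs × 2 ℕ.* sum λs ≡ n

Enumerates : (List ℕ → Set) → List (List ℕ) → Set
Enumerates P L =
  All P L × AllPairs _≢_ L × (∀ x → P x → x ∈ L)

-- Every class of symbols has a unique reduced representative, one of whose rows avoids 0: undo
-- shifts while both rows end in 0. The entries of a reduced symbol of rank n are at most n, so the
-- classes of rank n are enumerated by a finite list of reduced symbols. On reduced symbols, moving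
-- the largest element of A △ B to the other row is an involution that preserves the rank and changes
-- the defect by ±2, so it matches Φ⁺ₙ with Φ⁻ₙ except for its fixed points (A , A). The rank of
-- (A , A) is 2|λ|, where λ is the partition whose β-set is A, so these are counted by p(n/2).

{-# OPTIONS --safe #-}
module Submission where

open import Defs

open import Data.Nat as ℕ
  using (ℕ; zero; suc; _+_; _*_; _∸_; _^_; _≤_; _<_; _>_; _<?_; z≤n; s≤s; s≤s⁻¹)
open import Data.Nat.Properties
open import Data.Nat.DivMod using (_/_; +-distrib-/-∣ʳ; m*n/n≡m)
open import Data.Nat.Divisibility using (divides; _∣?_; _∣0)
open import Data.Nat.ListAction using (sum)
open import Data.Nat.ListAction.Properties using (sum-++; sum-↭)
import Data.Nat.Tactic.RingSolver as ℕ-Solver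
open import Algebra.Properties.CommutativeSemigroup +-commutativeSemigroup
  using () renaming (interchange to +-interchange; x∙yz≈y∙xz to x+[y+z]≡y+[x+z])
open import Data.Integer as ℤ using (ℤ; +_; _-_; _⊖_)
import Data.Integer.Properties as ℤ
open import Data.Integer.Divisibility using (_∣_)
import Data.Integer.Divisibility.Signed as Signed
import Data.Integer.Tactic.RingSolver as ℤ-Solver
open import Data.List using (List; []; _∷_; map; length; _++_; [_]; filter; cartesianProduct)
open import Data.List.Properties using (length-++; length-map; ∷-injectiveʳ; ≡-dec)
open import Data.List.Relation.Unary.All as All using (All; []; _∷_; all?)
import Data.List.Relation.Unary.All.Properties as All
open import Data.List.Relation.Unary.AllPairs as AllPairs using (AllPairs)
import Data.List.Relation.Unary.AllPairs.Properties as AllPairs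
open import Data.List.Relation.Unary.Any as Any using (here)
open import Data.List.Relation.Unary.Linked as Linked using (Linked; []; [-]; _∷_)
open import Data.List.Relation.Unary.Linked.Properties using (Linked⇒AllPairs)
open import Data.List.Relation.Unary.Unique.Propositional using (Unique)
import Data.List.Relation.Unary.Unique.Propositional.Properties as Unique
open import Data.List.Membership.Propositional using (_∈_)
open import Data.List.Membership.Propositional.Properties
  using (∈-++⁺ˡ; ∈-++⁺ʳ; ∈-++⁻; ∈-map⁺; ∈-map⁻; ∈-filter⁺; ∈-filter⁻;
         ∈-cartesianProduct⁺; ∈-cartesianProduct⁻)
open import Data.List.Relation.Binary.Permutation.Propositional
  using (_↭_; prep; ↭-refl; ↭-sym; module PermutationReasoning)
open import Data.List.Relation.Binary.Permutation.Propositional.Properties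
  using (↭-length; All-resp-↭) renaming (shift to ↭-shift)
open import Data.Product as Product using (Σ; _×_; _,_; proj₁; proj₂; uncurry)
open import Data.Sum as Sum using (_⊎_; inj₁; inj₂)
open import Data.Empty using (⊥-elim)
open import Function using (_∘_; id)
open import Relation.Nullary using (¬_; yes; no; _⊎-dec_; _×-dec_)
open import Relation.Unary using (Decidable)
open import Relation.Unary.Properties using (∁?)
open import Relation.Binary.Definitions using (tri<; tri≈; tri>)
open import Relation.Binary.PropositionalEquality hiding ([_])
open import Relation.Binary.Construct.Closure.Equivalence using (gfold)
open import Relation.Binary.Construct.Closure.ReflexiveTransitive using (ε; _◅_)
open import Relation.Binary.Construct.Closure.Symmetric using (bwd)

-- Arithmetic of the rank

triangular : ℕ → ℕ
triangular zero    = zero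
triangular (suc m) = m + triangular m

rankOffset : ℕ → ℕ
rankOffset s = ((s ∸ 1) ^ 2) / 4

rankOffset-+2 : ∀ s → rankOffset (2 + s) ≡ s + rankOffset s
rankOffset-+2 zero    = refl
rankOffset-+2 (suc t) = begin
  (suc (suc t) ^ 2) / 4         ≡⟨ cong (_/ 4) (square-+2 t) ⟩
  (t ^ 2 + suc t * 4) / 4       ≡⟨ +-distrib-/-∣ʳ (t ^ 2) (divides (suc t) refl) ⟩
  t ^ 2 / 4 + suc t * 4 / 4     ≡⟨ cong (λ x → t ^ 2 / 4 + x) (m*n/n≡m (suc t) 4) ⟩
  t ^ 2 / 4 + suc t             ≡⟨ +-comm (t ^ 2 / 4) (suc t) ⟩
  suc t + t ^ 2 / 4             ∎
  where
  open ≡-Reasoning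
  square-+2 : ∀ t → (2 + t) * ((2 + t) * 1) ≡ t * (t * 1) + (1 + t) * 4
  square-+2 = ℕ-Solver.solve-∀

rankOffset-suc-+-suc : ∀ x y → rankOffset (suc x + suc y) ≡ (x + y) + rankOffset (x + y)
rankOffset-suc-+-suc x y = trans (cong (λ s → rankOffset (suc s)) (+-suc x y)) (rankOffset-+2 (x + y))

rankOffset-double : ∀ m → rankOffset (m + m) ≡ triangular m + triangular m
rankOffset-double zero    = refl
rankOffset-double (suc m) = begin
  rankOffset (suc m + suc m)                     ≡⟨ rankOffset-suc-+-suc m m ⟩
  (m + m) + rankOffset (m + m)                   ≡⟨ cong (_+_ (m + m)) (rankOffset-double m) ⟩
  (m + m) + (triangular m + triangular m)        ≡⟨ +-interchange m m (triangular m) (triangular m) ⟩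
  (m + triangular m) + (m + triangular m)        ∎
  where open ≡-Reasoning

rankOffset≤triangular : ∀ m → rankOffset m ≤ triangular m
rankOffset≤triangular zero          = z≤n
rankOffset≤triangular (suc zero)    = z≤n
rankOffset≤triangular (suc (suc m)) = begin
  rankOffset (2 + m)             ≡⟨ rankOffset-+2 m ⟩
  m + rankOffset m               ≤⟨ +-monoʳ-≤ m (rankOffset≤triangular m) ⟩
  m + triangular m               ≤⟨ m≤n+m (m + triangular m) (suc m) ⟩
  suc m + (m + triangular m)     ∎
  where open ≤-Reasoning

rankOffset-+-≤ : ∀ x y → rankOffset (x + y) ≤ triangular x + triangular y
rankOffset-+-≤ zero    y       = rankOffset≤triangular y
rankOffset-+-≤ (suc x) zero    = begin
  rankOffset (suc x + 0)         ≡⟨ cong rankOffset (+-identityʳ (suc x)) ⟩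
  rankOffset (suc x)             ≤⟨ rankOffset≤triangular (suc x) ⟩
  triangular (suc x)             ≡⟨ +-identityʳ (triangular (suc x)) ⟨
  triangular (suc x) + 0         ∎
  where open ≤-Reasoning
rankOffset-+-≤ (suc x) (suc y) = begin
  rankOffset (suc x + suc y)                   ≡⟨ rankOffset-suc-+-suc x y ⟩
  (x + y) + rankOffset (x + y)                 ≤⟨ +-monoʳ-≤ (x + y) (rankOffset-+-≤ x y) ⟩
  (x + y) + (triangular x + triangular y)      ≡⟨ +-interchange x y (triangular x) (triangular y) ⟩
  (x + triangular x) + (y + triangular y)      ∎
  where open ≤-Reasoning

+[m+n]-+m≡+n : ∀ m n → + (m + n) - + m ≡ + n
+[m+n]-+m≡+n m n = trans (cong (_- + m) (ℤ.pos-+ m n)) (cancel (+ m) (+ n))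
  where
  cancel : ∀ i j → (i ℤ.+ j) - i ≡ j
  cancel = ℤ-Solver.solve-∀

sum≡⇒rank≡ : ∀ {A B n} → sum A + sum B ≡ rankOffset (size (A , B)) + n → rank (A , B) ≡ + n
sum≡⇒rank≡ {A} {B} {n} eq = trans (cong (λ m → + m - + o) eq) (+[m+n]-+m≡+n o n)
  where o = rankOffset (size (A , B))

rank≡⇒sum≡ : ∀ {A B n} → rank (A , B) ≡ + n → sum A + sum B ≡ rankOffset (size (A , B)) + n
rank≡⇒sum≡ {A} {B} {n} eq = ℤ.+-injective (begin
  + (sum A + sum B)                   ≡⟨ uncancel (+ (sum A + sum B)) (+ o) ⟩
  (+ (sum A + sum B) - + o) ℤ.+ + o   ≡⟨ cong (ℤ._+ + o) eq ⟩
  + n ℤ.+ + o                         ≡⟨ ℤ.pos-+ n o ⟨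
  + (n + o)                           ≡⟨ cong +_ (+-comm n o) ⟩
  + (o + n)                           ∎)
  where
  open ≡-Reasoning
  o = rankOffset (size (A , B))
  uncancel : ∀ i j → i ≡ (i - j) ℤ.+ j
  uncancel = ℤ-Solver.solve-∀

-- Shifts and reduced representatives

shiftRow : List ℕ → List ℕ
shiftRow A = map suc A ++ [ 0 ]

length-shiftRow : ∀ A → length (shiftRow A) ≡ suc (length A)
length-shiftRow []      = refl
length-shiftRow (a ∷ A) = cong suc (length-shiftRow A)

sum-shiftRow : ∀ A → sum (shiftRow A) ≡ length A + sum A
sum-shiftRow []      = refl
sum-shiftRow (a ∷ A) = begin
  suc a + sum (shiftRow A)       ≡⟨ cong (_+_ (suc a)) (sum-shiftRow A) ⟩
  suc a + (length A + sum A)     ≡⟨ cong suc (x+[y+z]≡y+[x+z] a (length A) (sum A)) ⟩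
  suc (length A + (a + sum A))   ∎
  where open ≡-Reasoning

rank-shift : ∀ Λ → rank (shift Λ) ≡ rank Λ
rank-shift (A , B) = begin
  + (sum (shiftRow A) + sum (shiftRow B)) - + rankOffset (length (shiftRow A) + length (shiftRow B))
    ≡⟨ cong₂ (λ m k → + m - + rankOffset k) sum-shift size-shift ⟩
  + (s + (sum A + sum B)) - + rankOffset (2 + s)
    ≡⟨ cong (λ k → + (s + (sum A + sum B)) - + k) (rankOffset-+2 s) ⟩
  + (s + (sum A + sum B)) - + (s + rankOffset s)
    ≡⟨ ℤ.[+m]-[+n]≡m⊖n (s + (sum A + sum B)) (s + rankOffset s) ⟩
  (s + (sum A + sum B)) ⊖ (s + rankOffset s)
    ≡⟨ ℤ.+-cancelˡ-⊖ s (sum A + sum B) (rankOffset s) ⟩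
  (sum A + sum B) ⊖ rankOffset s
    ≡⟨ ℤ.[+m]-[+n]≡m⊖n (sum A + sum B) (rankOffset s) ⟨
  + (sum A + sum B) - + rankOffset s
    ∎
  where
  open ≡-Reasoning
  s = length A + length B
  sum-shift : sum (shiftRow A) + sum (shiftRow B) ≡ s + (sum A + sum B)
  sum-shift = trans (cong₂ _+_ (sum-shiftRow A) (sum-shiftRow B))
                    (+-interchange (length A) (sum A) (length B) (sum B))
  size-shift : length (shiftRow A) + length (shiftRow B) ≡ 2 + s
  size-shift = trans (cong₂ _+_ (length-shiftRow A) (length-shiftRow B))
                     (cong suc (+-suc (length A) (length B)))

defect-suc : ∀ p q → + suc p - + suc q ≡ + p - + q
defect-suc p q = begin
  + suc p - + suc q  ≡⟨ ℤ.[+m]-[+n]≡m⊖n (suc p) (suc q) ⟩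
  suc p ⊖ suc q      ≡⟨ ℤ.[1+m]⊖[1+n]≡m⊖n p q ⟩
  p ⊖ q              ≡⟨ ℤ.[+m]-[+n]≡m⊖n p q ⟨
  + p - + q          ∎
  where open ≡-Reasoning

defect-shift : ∀ Λ → defect (shift Λ) ≡ defect Λ
defect-shift (A , B) = trans (cong₂ (λ p q → + p - + q) (length-shiftRow A) (length-shiftRow B))
                             (defect-suc (length A) (length B))

∼-invariant : {X : Set} (f : RawSymbol → X) → (∀ Λ → f (shift Λ) ≡ f Λ) →
              ∀ {Λ Λ′} → Λ ∼ Λ′ → f Λ ≡ f Λ′
∼-invariant f f-shift = gfold isEquivalence f (λ { {Λ} refl → sym (f-shift Λ) })

-- For a symbol this says that it is not a shift: both rows of `shift Λ` end in 0.
Reduced : RawSymbol → Set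
Reduced (A , B) = All (0 <_) A ⊎ All (0 <_) B

Reduced? : Decidable Reduced
Reduced? (A , B) = all? (0 <?_) A ⊎-dec all? (0 <?_) B

shift-not-Reduced : ∀ Λ → ¬ Reduced (shift Λ)
shift-not-Reduced (A , B) (inj₁ pos) with () ∷ _ ← All.++⁻ʳ (map suc A) pos
shift-not-Reduced (A , B) (inj₂ pos) with () ∷ _ ← All.++⁻ʳ (map suc B) pos

unshiftRow : List ℕ → List ℕ
unshiftRow []          = []
unshiftRow (zero ∷ _)  = []
unshiftRow (suc a ∷ A) = a ∷ unshiftRow A

unshift : RawSymbol → RawSymbol
unshift (A , B) = unshiftRow A , unshiftRow B

unshiftRow-shiftRow : ∀ A → unshiftRow (shiftRow A) ≡ A
unshiftRow-shiftRow []      = refl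
unshiftRow-shiftRow (a ∷ A) = cong (a ∷_) (unshiftRow-shiftRow A)

unshift-shift : ∀ Λ → unshift (shift Λ) ≡ Λ
unshift-shift (A , B) = cong₂ _,_ (unshiftRow-shiftRow A) (unshiftRow-shiftRow B)

shiftRow-unshiftRow : ∀ {A} → Linked _>_ A → ¬ All (0 <_) A → shiftRow (unshiftRow A) ≡ A
shiftRow-unshiftRow {[]}          _        not-pos = ⊥-elim (not-pos [])
shiftRow-unshiftRow {zero ∷ []}   _        _       = refl
shiftRow-unshiftRow {zero ∷ _ ∷ _} (() ∷ _) _
shiftRow-unshiftRow {suc a ∷ A}   A↘       not-pos =
  cong (suc a ∷_) (shiftRow-unshiftRow (Linked.tail A↘) (λ pos → not-pos (s≤s z≤n ∷ pos)))

shift-unshift : ∀ {Λ} → IsSymbol Λ → ¬ Reduced Λ → shift (unshift Λ) ≡ Λ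
shift-unshift (A↘ , B↘) not-reduced =
  cong₂ _,_ (shiftRow-unshiftRow A↘ (not-reduced ∘ inj₁)) (shiftRow-unshiftRow B↘ (not-reduced ∘ inj₂))

unshiftRow-decreasing : ∀ {A} → Linked _>_ A → Linked _>_ (unshiftRow A)
unshiftRow-decreasing {[]}                 _            = []
unshiftRow-decreasing {zero ∷ _}           _            = []
unshiftRow-decreasing {suc a ∷ []}         _            = [-]
unshiftRow-decreasing {suc a ∷ zero ∷ _}   _            = [-]
unshiftRow-decreasing {suc a ∷ suc b ∷ A}  (s≤s b<a ∷ A↘) = b<a ∷ unshiftRow-decreasing A↘

unshift-IsSymbol : ∀ {Λ} → IsSymbol Λ → IsSymbol (unshift Λ)
unshift-IsSymbol (A↘ , B↘) = unshiftRow-decreasing A↘ , unshiftRow-decreasing B↘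

-- Each unshift shortens the first row, so its length is enough fuel.
reduceWithin : ℕ → RawSymbol → RawSymbol
reduceWithin zero    Λ = Λ
reduceWithin (suc k) Λ with Reduced? Λ
... | yes _ = Λ
... | no  _ = reduceWithin k (unshift Λ)

reduce : RawSymbol → RawSymbol
reduce Λ = reduceWithin (length (proj₁ Λ)) Λ

reduceWithin-IsSymbol : ∀ k {Λ} → IsSymbol Λ → IsSymbol (reduceWithin k Λ)
reduceWithin-IsSymbol zero        Λ-sym = Λ-sym
reduceWithin-IsSymbol (suc k) {Λ} Λ-sym with Reduced? Λ
... | yes _ = Λ-sym
... | no  _ = reduceWithin-IsSymbol k (unshift-IsSymbol Λ-sym)

reduceWithin-∼ : ∀ k {Λ} → IsSymbol Λ → Λ ∼ reduceWithin k Λ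
reduceWithin-∼ zero        _     = ε
reduceWithin-∼ (suc k) {Λ} Λ-sym with Reduced? Λ
... | yes _           = ε
... | no  not-reduced =
  bwd (sym (shift-unshift Λ-sym not-reduced)) ◅ reduceWithin-∼ k (unshift-IsSymbol Λ-sym)

reduceWithin-Reduced : ∀ k {Λ} → IsSymbol Λ → length (proj₁ Λ) ≤ k → Reduced (reduceWithin k Λ)
reduceWithin-Reduced zero    {[] , B} _     _ = inj₁ []
reduceWithin-Reduced (suc k) {Λ}      Λ-sym fuel with Reduced? Λ
... | yes reduced     = reduced
... | no  not-reduced = reduceWithin-Reduced k (unshift-IsSymbol Λ-sym) (s≤s⁻¹ (begin
  suc (length (unshiftRow (proj₁ Λ)))       ≡⟨ length-shiftRow (unshiftRow (proj₁ Λ)) ⟨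
  length (shiftRow (unshiftRow (proj₁ Λ)))  ≡⟨ cong (length ∘ proj₁) (shift-unshift Λ-sym not-reduced) ⟩
  length (proj₁ Λ)                          ≤⟨ fuel ⟩
  suc k                                     ∎))
  where open ≤-Reasoning

reduceWithin-Reduced-id : ∀ k {Λ} → Reduced Λ → reduceWithin k Λ ≡ Λ
reduceWithin-Reduced-id zero        _       = refl
reduceWithin-Reduced-id (suc k) {Λ} reduced with Reduced? Λ
... | yes _           = refl
... | no  not-reduced = ⊥-elim (not-reduced reduced)

reduce-shift : ∀ Λ → reduce (shift Λ) ≡ reduce Λ
reduce-shift Λ@(A , B) rewrite length-shiftRow A with Reduced? (shift Λ)
... | yes reduced = ⊥-elim (shift-not-Reduced Λ reduced)
... | no  _       = cong (reduceWithin (length A)) (unshift-shift Λ)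

reduce-IsSymbol : ∀ {Λ} → IsSymbol Λ → IsSymbol (reduce Λ)
reduce-IsSymbol {Λ} = reduceWithin-IsSymbol (length (proj₁ Λ))

reduce-Reduced : ∀ {Λ} → IsSymbol Λ → Reduced (reduce Λ)
reduce-Reduced {Λ} Λ-sym = reduceWithin-Reduced (length (proj₁ Λ)) Λ-sym ≤-refl

∼-reduce : ∀ {Λ} → IsSymbol Λ → Λ ∼ reduce Λ
∼-reduce {Λ} = reduceWithin-∼ (length (proj₁ Λ))

Reduced-∼⇒≡ : ∀ {Λ Λ′} → Reduced Λ → Reduced Λ′ → Λ ∼ Λ′ → Λ ≡ Λ′
Reduced-∼⇒≡ {Λ} {Λ′} reduced reduced′ Λ∼Λ′ = begin
  Λ           ≡⟨ reduceWithin-Reduced-id (length (proj₁ Λ)) reduced ⟨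
  reduce Λ    ≡⟨ ∼-invariant reduce reduce-shift Λ∼Λ′ ⟩
  reduce Λ′   ≡⟨ reduceWithin-Reduced-id (length (proj₁ Λ′)) reduced′ ⟩
  Λ′          ∎
  where open ≡-Reasoning

-- Reduced symbols of rank n have entries at most n

All-<-head : ∀ {x L} → Linked _>_ (x ∷ L) → All (_< x) L
All-<-head x∷L↘ = AllPairs.head (Linked⇒AllPairs (λ y<x z<y → <-trans z<y y<x) x∷L↘)

lowerBound+length≤head : ∀ {m x L} → Linked _>_ (x ∷ L) → All (m ≤_) (x ∷ L) → m + length L ≤ x
lowerBound+length≤head {m} {x} {[]}    _            (m≤x ∷ _) =
  ≤-trans (≤-reflexive (+-identityʳ m)) m≤x
lowerBound+length≤head {m} {x} {y ∷ L} (y<x ∷ y∷L↘) (_ ∷ m≤y∷L) = begin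
  m + suc (length L)   ≡⟨ +-suc m (length L) ⟩
  suc (m + length L)   ≤⟨ s≤s (lowerBound+length≤head y∷L↘ m≤y∷L) ⟩
  suc y                ≤⟨ y<x ⟩
  x                    ∎
  where open ≤-Reasoning

All-<⇒Linked-∷ : ∀ {x L} → All (_< x) L → Linked _>_ L → Linked _>_ (x ∷ L)
All-<⇒Linked-∷ []        _  = [-]
All-<⇒Linked-∷ (y<x ∷ _) L↘ = y<x ∷ L↘

triangular-≤-sum : ∀ {m L} → Linked _>_ L → All (m ≤_) L →
                   triangular (m + length L) ≤ triangular m + sum L
triangular-≤-sum {m} {[]}    _   _ =
  ≤-reflexive (trans (cong triangular (+-identityʳ m)) (sym (+-identityʳ (triangular m))))
triangular-≤-sum {m} {x ∷ L} x∷L↘ m≤x∷L@(_ ∷ m≤L) = begin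
  triangular (m + suc (length L))      ≡⟨ cong triangular (+-suc m (length L)) ⟩
  (m + length L) + triangular (m + length L)
    ≤⟨ +-mono-≤ (lowerBound+length≤head x∷L↘ m≤x∷L) (triangular-≤-sum (Linked.tail x∷L↘) m≤L) ⟩
  x + (triangular m + sum L)           ≡⟨ x+[y+z]≡y+[x+z] x (triangular m) (sum L) ⟩
  triangular m + (x + sum L)           ∎
  where open ≤-Reasoning

-- The tail of a row sums to at least `triangular` of its length, one step more if the row is
-- positive; this extra step lets the two tails cover `rankOffset` via `rankOffset-+-≤`.
head+rankOffset≤sum : ∀ {a A B} → IsSymbol (a ∷ A , B) → Reduced (a ∷ A , B) →
                      a + rankOffset (size (a ∷ A , B)) ≤ sum (a ∷ A) + sum B
head+rankOffset≤sum {a} {A} {B} (a∷A↘ , B↘) (inj₁ (_ ∷ A-pos)) = begin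
  a + rankOffset (suc (length A) + length B)
    ≤⟨ +-monoʳ-≤ a (rankOffset-+-≤ (suc (length A)) (length B)) ⟩
  a + (triangular (suc (length A)) + triangular (length B))
    ≤⟨ +-monoʳ-≤ a (+-mono-≤ (triangular-≤-sum (Linked.tail a∷A↘) A-pos)
                             (triangular-≤-sum B↘ (All.universal (λ _ → z≤n) B))) ⟩
  a + (sum A + sum B)
    ≡⟨ +-assoc a (sum A) (sum B) ⟨
  a + sum A + sum B
    ∎
  where open ≤-Reasoning
head+rankOffset≤sum {a} {A} {B} (a∷A↘ , B↘) (inj₂ B-pos) = begin
  a + rankOffset (suc (length A) + length B)
    ≡⟨ cong (λ s → a + rankOffset s) (+-suc (length A) (length B)) ⟨
  a + rankOffset (length A + suc (length B))
    ≤⟨ +-monoʳ-≤ a (rankOffset-+-≤ (length A) (suc (length B))) ⟩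
  a + (triangular (length A) + triangular (suc (length B)))
    ≤⟨ +-monoʳ-≤ a (+-mono-≤ (triangular-≤-sum (Linked.tail a∷A↘) (All.universal (λ _ → z≤n) A))
                             (triangular-≤-sum B↘ B-pos)) ⟩
  a + (sum A + sum B)
    ≡⟨ +-assoc a (sum A) (sum B) ⟨
  a + sum A + sum B
    ∎
  where open ≤-Reasoning

firstRow≤rank : ∀ {A B n} → IsSymbol (A , B) → Reduced (A , B) → rank (A , B) ≡ + n → All (_≤ n) A
firstRow≤rank {[]}          _                   _       _      = []
firstRow≤rank {a ∷ A} {B} {n} Λ-sym@(a∷A↘ , _) reduced rank≡n =
  a≤n ∷ All.map (λ x<a → ≤-trans (<⇒≤ x<a) a≤n) (All-<-head a∷A↘)
  where
  o = rankOffset (size (a ∷ A , B))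
  a≤n : a ≤ n
  a≤n = +-cancelˡ-≤ o a n (begin
    o + a                  ≡⟨ +-comm o a ⟩
    a + o                  ≤⟨ head+rankOffset≤sum Λ-sym reduced ⟩
    sum (a ∷ A) + sum B    ≡⟨ rank≡⇒sum≡ {a ∷ A} {B} rank≡n ⟩
    o + n                  ∎)
    where open ≤-Reasoning

rank-swap : ∀ A B → rank (B , A) ≡ rank (A , B)
rank-swap A B =
  cong₂ (λ s l → + s - + rankOffset l) (+-comm (sum B) (sum A)) (+-comm (length B) (length A))

entries≤rank : ∀ {A B n} → IsSymbol (A , B) → Reduced (A , B) → rank (A , B) ≡ + n →
               All (_≤ n) A × All (_≤ n) B
entries≤rank {A} {B} Λ-sym reduced rank≡n =
  firstRow≤rank Λ-sym reduced rank≡n ,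
  firstRow≤rank (Product.swap Λ-sym) (Sum.swap reduced) (trans (rank-swap A B) rank≡n)

-- Enumerating the classes

decreasingBelow : ℕ → List (List ℕ)
decreasingBelow zero    = [ [] ]
decreasingBelow (suc k) = decreasingBelow k ++ map (k ∷_) (decreasingBelow k)

∈-decreasingBelow⁻ : ∀ k {A} → A ∈ decreasingBelow k → Linked _>_ A × All (_< k) A
∈-decreasingBelow⁻ zero    (here refl) = [] , []
∈-decreasingBelow⁻ (suc k) A∈ with ∈-++⁻ (decreasingBelow k) A∈
... | inj₁ A∈′ = Product.map₂ (All.map m<n⇒m<1+n) (∈-decreasingBelow⁻ k A∈′)
... | inj₂ A∈′ with ∈-map⁻ (k ∷_) A∈′
...   | A′ , A′∈ , refl with ∈-decreasingBelow⁻ k A′∈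
...     | A′↘ , A′<k = All-<⇒Linked-∷ A′<k A′↘ , ≤-refl ∷ All.map m<n⇒m<1+n A′<k

∈-decreasingBelow⁺ : ∀ k {A} → Linked _>_ A → All (_< k) A → A ∈ decreasingBelow k
∈-decreasingBelow⁺ zero    {[]}    _   _        = here refl
∈-decreasingBelow⁺ zero    {_ ∷ _} _   (() ∷ _)
∈-decreasingBelow⁺ (suc k) {[]}    _   _ = ∈-++⁺ˡ (∈-decreasingBelow⁺ k [] [])
∈-decreasingBelow⁺ (suc k) {a ∷ A} a∷A↘ (a<1+k ∷ _) with m<1+n⇒m<n∨m≡n a<1+k
... | inj₁ a<k  = ∈-++⁺ˡ
  (∈-decreasingBelow⁺ k a∷A↘ (a<k ∷ All.map (λ x<a → <-trans x<a a<k) (All-<-head a∷A↘)))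
... | inj₂ refl = ∈-++⁺ʳ (decreasingBelow k)
                    (∈-map⁺ (k ∷_) (∈-decreasingBelow⁺ k (Linked.tail a∷A↘) (All-<-head a∷A↘)))

decreasingBelow-Unique : ∀ k → Unique (decreasingBelow k)
decreasingBelow-Unique zero    = [] AllPairs.∷ AllPairs.[]
decreasingBelow-Unique (suc k) =
  Unique.++⁺ (decreasingBelow-Unique k) (Unique.map⁺ ∷-injectiveʳ (decreasingBelow-Unique k)) disjoint
  where
  disjoint : ∀ {A} → ¬ (A ∈ decreasingBelow k × A ∈ map (k ∷_) (decreasingBelow k))
  disjoint (A∈ , A∈′) with ∈-map⁻ (k ∷_) A∈′
  ... | _ , _ , refl with ∈-decreasingBelow⁻ k A∈
  ...   | _ , (k<k ∷ _) = <-irrefl refl k<k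

candidates : ℕ → List RawSymbol
candidates n = filter Reduced? (cartesianProduct (decreasingBelow (suc n)) (decreasingBelow (suc n)))

∈-candidates⁻ : ∀ {n Λ} → Λ ∈ candidates n → IsSymbol Λ × Reduced Λ
∈-candidates⁻ {n} Λ∈ with ∈-filter⁻ Reduced? Λ∈
... | Λ∈′ , reduced with ∈-cartesianProduct⁻ (decreasingBelow (suc n)) (decreasingBelow (suc n)) Λ∈′
...   | A∈ , B∈ =
  (proj₁ (∈-decreasingBelow⁻ (suc n) A∈) , proj₁ (∈-decreasingBelow⁻ (suc n) B∈)) , reduced

∈-candidates⁺ : ∀ {n Λ} → IsSymbol Λ → Reduced Λ → rank Λ ≡ + n → Λ ∈ candidates n
∈-candidates⁺ {n} Λ-sym@(A↘ , B↘) reduced rank≡n with entries≤rank Λ-sym reduced rank≡n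
... | A≤n , B≤n = ∈-filter⁺ Reduced?
  (∈-cartesianProduct⁺ (∈-decreasingBelow⁺ (suc n) A↘ (All.map s≤s A≤n))
                       (∈-decreasingBelow⁺ (suc n) B↘ (All.map s≤s B≤n)))
  reduced

candidates-Unique : ∀ n → Unique (candidates n)
candidates-Unique n = Unique.filter⁺ Reduced?
  (Unique.cartesianProduct⁺ (decreasingBelow-Unique (suc n)) (decreasingBelow-Unique (suc n)))

AllPairs-mapWith-All : ∀ {X : Set} {P : X → Set} {R S : X → X → Set} →
                       (∀ {x y} → P x → P y → R x y → S x y) →
                       ∀ {xs} → All P xs → AllPairs R xs → AllPairs S xs
AllPairs-mapWith-All f []         AllPairs.[]         = AllPairs.[]
AllPairs-mapWith-All f (px ∷ pxs) (rx AllPairs.∷ rxs) =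
  All.zipWith (λ (py , r) → f px py r) (pxs , rx) AllPairs.∷ AllPairs-mapWith-All f pxs rxs

reduced-enumeratesClasses : ∀ {P L} → (∀ {Λ Λ′} → Λ ∼ Λ′ → P Λ → P Λ′) →
                            All (λ Λ → IsSymbol Λ × Reduced Λ × P Λ) L → Unique L →
                            (∀ {Λ} → IsSymbol Λ → Reduced Λ → P Λ → Λ ∈ L) →
                            EnumeratesClasses P L
reduced-enumeratesClasses P-∼ L-valid L-unique L-complete =
  All.map (λ (Λ-sym , _ , p) → Λ-sym , p) L-valid ,
  AllPairs-mapWith-All
    (λ (_ , reduced , _) (_ , reduced′ , _) Λ≢Λ′ →
       Λ≢Λ′ ∘ Reduced-∼⇒≡ reduced reduced′)
    L-valid L-unique ,
  λ Λ Λ-sym p → Any.map (λ { refl → ∼-reduce Λ-sym })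
    (L-complete (reduce-IsSymbol Λ-sym) (reduce-Reduced Λ-sym) (P-∼ (∼-reduce Λ-sym) p))

filter-candidates-enumeratesClasses : ∀ {n P} (P? : Decidable P) →
                                      (∀ {Λ} → P Λ → rank Λ ≡ + n) →
                                      (∀ {Λ Λ′} → Λ ∼ Λ′ → P Λ → P Λ′) →
                                      EnumeratesClasses P (filter P? (candidates n))
filter-candidates-enumeratesClasses {n} {P} P? P⇒rank≡n P-∼ =
  reduced-enumeratesClasses P-∼ (All.tabulate valid) (Unique.filter⁺ P? (candidates-Unique n))
    (λ Λ-sym reduced p → ∈-filter⁺ P? (∈-candidates⁺ Λ-sym reduced (P⇒rank≡n p)) p)
  where
  valid : ∀ {Λ} → Λ ∈ filter P? (candidates n) → IsSymbol Λ × Reduced Λ × P Λ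
  valid Λ∈ with ∈-filter⁻ P? {xs = candidates n} Λ∈
  ... | Λ∈′ , p = Product.map₂ (_, p) (∈-candidates⁻ {n} Λ∈′)

-- Moves the largest element of the symmetric difference A △ B to the other row. As A △ B does not
-- change, this is an involution, fixing exactly the symbols with A ≡ B.
moveTop : List ℕ → List ℕ → RawSymbol
moveTop []      []      = [] , []
moveTop (a ∷ A) []      = A , [ a ]
moveTop []      (b ∷ B) = [ b ] , B
moveTop (a ∷ A) (b ∷ B) with <-cmp a b
... | tri< _ _ _ = b ∷ a ∷ A , B
... | tri≈ _ _ _ = Product.map (a ∷_) (b ∷_) (moveTop A B)
... | tri> _ _ _ = A , a ∷ b ∷ B

entries : RawSymbol → List ℕ
entries (A , B) = A ++ B

moveTop-entries : ∀ A B → entries (moveTop A B) ↭ A ++ B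
moveTop-entries []      []      = ↭-refl
moveTop-entries (a ∷ A) []      = ↭-shift a A []
moveTop-entries []      (b ∷ B) = ↭-refl
moveTop-entries (a ∷ A) (b ∷ B) with <-cmp a b
... | tri< _ _ _ = ↭-sym (↭-shift b (a ∷ A) B)
... | tri> _ _ _ = ↭-shift a A (b ∷ B)
... | tri≈ _ _ _ = prep a (begin
  proj₁ (moveTop A B) ++ b ∷ proj₂ (moveTop A B)   ↭⟨ ↭-shift b (proj₁ (moveTop A B)) _ ⟩
  b ∷ entries (moveTop A B)                        ↭⟨ prep b (moveTop-entries A B) ⟩
  b ∷ A ++ B                                       ↭⟨ ↭-shift b A B ⟨
  A ++ b ∷ B                                       ∎)
  where open PermutationReasoning

rank-↭ : ∀ {Λ Λ′} → entries Λ ↭ entries Λ′ → rank Λ ≡ rank Λ′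
rank-↭ {A , B} {A′ , B′} p = cong₂ (λ s l → + s - + rankOffset l)
  (trans (sym (sum-++ A B)) (trans (sum-↭ p) (sum-++ A′ B′)))
  (trans (sym (length-++ A)) (trans (↭-length p) (length-++ A′)))

moveTop-rank : ∀ A B → rank (moveTop A B) ≡ rank (A , B)
moveTop-rank A B = rank-↭ {moveTop A B} {A , B} (moveTop-entries A B)

defect-transfer : ∀ p q → + p - + suc q ≡ (+ suc p - + q) - + 2
defect-transfer p q = lemma (+ p) (+ q)
  where
  lemma : ∀ i j → i - (+ 1 ℤ.+ j) ≡ ((+ 1 ℤ.+ i) - j) - + 2
  lemma = ℤ-Solver.solve-∀

TwoApart : ℤ → ℤ → Set
TwoApart d d′ = d′ ≡ d - + 2 ⊎ d ≡ d′ - + 2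

moveTop-defect : ∀ {A B} → A ≢ B → TwoApart (defect (A , B)) (defect (moveTop A B))
moveTop-defect {[]}    {[]}    A≢B = ⊥-elim (A≢B refl)
moveTop-defect {a ∷ A} {[]}    _   = inj₁ (defect-transfer (length A) 0)
moveTop-defect {[]}    {b ∷ B} _   = inj₂ (defect-transfer 0 (length B))
moveTop-defect {a ∷ A} {b ∷ B} A≢B with <-cmp a b
... | tri< _ _ _  = inj₂ (defect-transfer (suc (length A)) (length B))
... | tri> _ _ _  = inj₁ (defect-transfer (length A) (suc (length B)))
... | tri≈ _ refl _
  rewrite defect-suc (length A) (length B)
        | defect-suc (length (proj₁ (moveTop A B))) (length (proj₂ (moveTop A B)))
  = moveTop-defect (A≢B ∘ cong (a ∷_))

moveTop-IsSymbol : ∀ {A B} → IsSymbol (A , B) → IsSymbol (moveTop A B)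
moveTop-IsSymbol {[]}    {[]}    _             = [] , []
moveTop-IsSymbol {a ∷ A} {[]}    (a∷A↘ , _)    = Linked.tail a∷A↘ , [-]
moveTop-IsSymbol {[]}    {b ∷ B} (_ , b∷B↘)    = [-] , Linked.tail b∷B↘
moveTop-IsSymbol {a ∷ A} {b ∷ B} (a∷A↘ , b∷B↘) with <-cmp a b
... | tri< a<b _ _ = a<b ∷ a∷A↘ , Linked.tail b∷B↘
... | tri> _ _ b<a = Linked.tail a∷A↘ , b<a ∷ b∷B↘
... | tri≈ _ refl _ with moveTop-IsSymbol (Linked.tail a∷A↘ , Linked.tail b∷B↘)
...   | A′↘ , B′↘ = All-<⇒Linked-∷ A′<a A′↘ , All-<⇒Linked-∷ B′<a B′↘
  where
  A′B′<a : All (_< a) (entries (moveTop A B))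
  A′B′<a = All-resp-↭ (↭-sym (moveTop-entries A B)) (All.++⁺ (All-<-head a∷A↘) (All-<-head b∷B↘))
  A′<a = All.++⁻ˡ (proj₁ (moveTop A B)) A′B′<a
  B′<a = All.++⁻ʳ (proj₁ (moveTop A B)) A′B′<a

moveTop-Reduced : ∀ {A B} → IsSymbol (A , B) → Reduced (A , B) → Reduced (moveTop A B)
moveTop-Reduced {[]}            {[]}            _             _       = inj₁ []
moveTop-Reduced {zero ∷ []}     {[]}            _             _       = inj₁ []
moveTop-Reduced {zero ∷ _ ∷ _}  {[]}            ((() ∷ _) , _) _
moveTop-Reduced {suc a ∷ A}     {[]}            _             _       = inj₂ (0<1+n ∷ [])
moveTop-Reduced {[]}            {zero ∷ []}     _             _       = inj₂ []
moveTop-Reduced {[]}            {zero ∷ _ ∷ _}  (_ , (() ∷ _)) _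
moveTop-Reduced {[]}            {suc b ∷ B}     _             _       = inj₁ (0<1+n ∷ [])
moveTop-Reduced {a ∷ A}         {b ∷ B}         (a∷A↘ , b∷B↘) reduced with <-cmp a b | reduced
... | tri< a<b _ _ | inj₁ a∷A-pos       = inj₁ (<-≤-trans 0<1+n a<b ∷ a∷A-pos)
... | tri< _ _ _   | inj₂ (_ ∷ B-pos)   = inj₂ B-pos
... | tri> _ _ _   | inj₁ (_ ∷ A-pos)   = inj₁ A-pos
... | tri> _ _ b<a | inj₂ b∷B-pos       = inj₂ (<-≤-trans 0<1+n b<a ∷ b∷B-pos)
... | tri≈ _ refl _ | _ =
  Sum.map (0<a ∷_) (0<a ∷_)
          (moveTop-Reduced (Linked.tail a∷A↘ , Linked.tail b∷B↘) (Sum.map All.tail All.tail reduced))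
  where
  0<a : 0 < a
  0<a = Sum.[ All.head , All.head ] reduced

moveTop-< : ∀ {a A b B} → a < b → moveTop (a ∷ A) (b ∷ B) ≡ (b ∷ a ∷ A , B)
moveTop-< {a} {_} {b} a<b with <-cmp a b
... | tri< _ _ _    = refl
... | tri≈ a≮b _ _  = ⊥-elim (a≮b a<b)
... | tri> a≮b _ _  = ⊥-elim (a≮b a<b)

moveTop-> : ∀ {a A b B} → b < a → moveTop (a ∷ A) (b ∷ B) ≡ (A , a ∷ b ∷ B)
moveTop-> {a} {_} {b} b<a with <-cmp a b
... | tri< _ _ b≮a  = ⊥-elim (b≮a b<a)
... | tri≈ _ _ b≮a  = ⊥-elim (b≮a b<a)
... | tri> _ _ _    = refl

moveTop-≡ : ∀ a A B → moveTop (a ∷ A) (a ∷ B) ≡ Product.map (a ∷_) (a ∷_) (moveTop A B)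
moveTop-≡ a A B with <-cmp a a
... | tri< a<a _ _  = ⊥-elim (<-irrefl refl a<a)
... | tri≈ _ _ _    = refl
... | tri> _ _ a<a  = ⊥-elim (<-irrefl refl a<a)

moveTop-insertˡ : ∀ {a A B} → Linked _>_ (a ∷ A) → moveTop A (a ∷ B) ≡ (a ∷ A , B)
moveTop-insertˡ {A = []}    _           = refl
moveTop-insertˡ {A = _ ∷ _} (x<a ∷ _)   = moveTop-< x<a

moveTop-insertʳ : ∀ {b A B} → Linked _>_ (b ∷ B) → moveTop (b ∷ A) B ≡ (A , b ∷ B)
moveTop-insertʳ {B = []}    _           = refl
moveTop-insertʳ {B = _ ∷ _} (y<b ∷ _)   = moveTop-> y<b

moveTop-involutive : ∀ {A B} → IsSymbol (A , B) → uncurry moveTop (moveTop A B) ≡ (A , B)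
moveTop-involutive {[]}    {[]}    _             = refl
moveTop-involutive {a ∷ A} {[]}    (a∷A↘ , _)    = moveTop-insertˡ a∷A↘
moveTop-involutive {[]}    {b ∷ B} (_ , b∷B↘)    = moveTop-insertʳ b∷B↘
moveTop-involutive {a ∷ A} {b ∷ B} (a∷A↘ , b∷B↘) with <-cmp a b
... | tri< _ _ _    = moveTop-insertʳ b∷B↘
... | tri> _ _ _    = moveTop-insertˡ a∷A↘
... | tri≈ _ refl _ = trans (moveTop-≡ a (proj₁ (moveTop A B)) (proj₂ (moveTop A B)))
  (cong (Product.map (a ∷_) (a ∷_)) (moveTop-involutive (Linked.tail a∷A↘ , Linked.tail b∷B↘)))

moveTop-diagonal : ∀ A → moveTop A A ≡ (A , A)
moveTop-diagonal []      = refl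
moveTop-diagonal (a ∷ A) =
  trans (moveTop-≡ a A A) (cong (Product.map (a ∷_) (a ∷_)) (moveTop-diagonal A))

moveTop-injective : ∀ {Λ Λ′} → IsSymbol Λ → IsSymbol Λ′ →
                    uncurry moveTop Λ ≡ uncurry moveTop Λ′ → Λ ≡ Λ′
moveTop-injective Λ-sym Λ′-sym eq =
  trans (sym (moveTop-involutive Λ-sym)) (trans (cong (uncurry moveTop) eq) (moveTop-involutive Λ′-sym))

Diagonal : RawSymbol → Set
Diagonal (A , B) = A ≡ B

Diagonal? : Decidable Diagonal
Diagonal? (A , B) = ≡-dec ℕ._≟_ A B

moveTop-offDiagonal : ∀ {A B} → IsSymbol (A , B) → A ≢ B → ¬ Diagonal (moveTop A B)
moveTop-offDiagonal {A} {B} Λ-sym A≢B diagonal =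
  A≢B (trans (cong proj₁ Λ≡C,C) (sym (cong proj₂ Λ≡C,C)))
  where
  C = proj₁ (moveTop A B)
  Λ≡C,C : (A , B) ≡ (C , C)
  Λ≡C,C = begin
    (A , B)                          ≡⟨ moveTop-involutive Λ-sym ⟨
    moveTop C (proj₂ (moveTop A B))  ≡⟨ cong (moveTop C) diagonal ⟨
    moveTop C C                      ≡⟨ moveTop-diagonal C ⟩
    (C , C)                          ∎
    where open ≡-Reasoning

-- Defects modulo 4

∣⇒∣-self : ∀ {k x} → k ∣ x → k ∣ x - k
∣⇒∣-self {k} {x} k∣x =
  Signed.∣⇒∣ᵤ {k} {x - k} (Signed.∣m∣n⇒∣m-n {k} {x} {k} (Signed.∣ᵤ⇒∣ {k} {x} k∣x) (Signed.∣-refl {k}))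

∣⇒∣+self : ∀ {k x} → k ∣ x → k ∣ x ℤ.+ k
∣⇒∣+self {k} {x} k∣x =
  Signed.∣⇒∣ᵤ {k} {x ℤ.+ k} (Signed.∣m∣n⇒∣m+n {k} {x} {k} (Signed.∣ᵤ⇒∣ {k} {x} k∣x) (Signed.∣-refl {k}))

TwoApart-4∣⇒4∣-2 : ∀ {d d′} → TwoApart d d′ → (+ 4) ∣ d → (+ 4) ∣ d′ - + 2
TwoApart-4∣⇒4∣-2 {d} (inj₁ refl) 4∣d = subst ((+ 4) ∣_) (sym (lemma d)) (∣⇒∣-self {+ 4} {d} 4∣d)
  where
  lemma : ∀ i → (i - + 2) - + 2 ≡ i - + 4
  lemma = ℤ-Solver.solve-∀
TwoApart-4∣⇒4∣-2 (inj₂ refl) 4∣d = 4∣d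

TwoApart-4∣-2⇒4∣ : ∀ {d d′} → TwoApart d d′ → (+ 4) ∣ d - + 2 → (+ 4) ∣ d′
TwoApart-4∣-2⇒4∣ (inj₁ refl) 4∣d-2 = 4∣d-2
TwoApart-4∣-2⇒4∣ {d′ = d′} (inj₂ refl) 4∣d-2 =
  subst ((+ 4) ∣_) (lemma d′) (∣⇒∣+self {+ 4} {(d′ - + 2) - + 2} 4∣d-2)
  where
  lemma : ∀ i → ((i - + 2) - + 2) ℤ.+ + 4 ≡ i
  lemma = ℤ-Solver.solve-∀

InPhiMinus⇒≢ : ∀ {n A B} → InPhiMinus n (A , B) → A ≢ B
InPhiMinus⇒≢ {A = A} (_ , 4∣d-2) refl
  with subst (λ d → (+ 4) ∣ d - + 2) (ℤ.+-inverseʳ (+ length A)) 4∣d-2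
... | divides zero    ()
... | divides (suc _) ()

moveTop-InPhiPlus : ∀ {n A B} → A ≢ B → InPhiPlus n (A , B) → InPhiMinus n (moveTop A B)
moveTop-InPhiPlus {A = A} {B} A≢B (rank≡n , 4∣d) =
  trans (moveTop-rank A B) rank≡n ,
  TwoApart-4∣⇒4∣-2 {defect (A , B)} {defect (moveTop A B)} (moveTop-defect {A} {B} A≢B) 4∣d

moveTop-InPhiMinus : ∀ {n A B} → InPhiMinus n (A , B) → InPhiPlus n (moveTop A B)
moveTop-InPhiMinus {n} {A} {B} Λ∈Φ⁻@(rank≡n , 4∣d-2) =
  trans (moveTop-rank A B) rank≡n ,
  TwoApart-4∣-2⇒4∣ {defect (A , B)} {defect (moveTop A B)}
                   (moveTop-defect {A} {B} (InPhiMinus⇒≢ {n} {A} {B} Λ∈Φ⁻)) 4∣d-2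

InPhiPlus-∼ : ∀ {n Λ Λ′} → Λ ∼ Λ′ → InPhiPlus n Λ → InPhiPlus n Λ′
InPhiPlus-∼ Λ∼Λ′ (rank≡n , 4∣d) =
  trans (sym (∼-invariant rank rank-shift Λ∼Λ′)) rank≡n ,
  subst ((+ 4) ∣_) (∼-invariant defect defect-shift Λ∼Λ′) 4∣d

InPhiMinus-∼ : ∀ {n Λ Λ′} → Λ ∼ Λ′ → InPhiMinus n Λ → InPhiMinus n Λ′
InPhiMinus-∼ Λ∼Λ′ (rank≡n , 4∣d-2) =
  trans (sym (∼-invariant rank rank-shift Λ∼Λ′)) rank≡n ,
  subst (λ d → (+ 4) ∣ d - + 2) (∼-invariant defect defect-shift Λ∼Λ′) 4∣d-2

InPhiPlus? : ∀ n → Decidable (InPhiPlus n)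
InPhiPlus? n Λ = (rank Λ ℤ.≟ + n) ×-dec (4 ∣? ℤ.∣ defect Λ ∣)

diagonal-InPhiPlus : ∀ {n A} → rank (A , A) ≡ + n → InPhiPlus n (A , A)
diagonal-InPhiPlus {A = A} rank≡n = rank≡n , subst ((+ 4) ∣_) (sym (ℤ.+-inverseʳ (+ length A))) (4 ∣0)

-- β-sets and partitions

-- A partition λ₁ ≥ … ≥ λₘ corresponds to its strictly decreasing β-set
-- λ₁ + (m - 1) > … > λₘ + 0.
betaSet : List ℕ → List ℕ
betaSet []      = []
betaSet (l ∷ L) = l + length L ∷ betaSet L

partitionOf : List ℕ → List ℕ
partitionOf []      = []
partitionOf (a ∷ A) = a ∸ length A ∷ partitionOf A

length-betaSet : ∀ L → length (betaSet L) ≡ length L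
length-betaSet []      = refl
length-betaSet (l ∷ L) = cong suc (length-betaSet L)

length-partitionOf : ∀ A → length (partitionOf A) ≡ length A
length-partitionOf []      = refl
length-partitionOf (a ∷ A) = cong suc (length-partitionOf A)

partitionOf-betaSet : ∀ L → partitionOf (betaSet L) ≡ L
partitionOf-betaSet []      = refl
partitionOf-betaSet (l ∷ L) = cong₂ _∷_
  (trans (cong (l + length L ∸_) (length-betaSet L)) (m+n∸n≡m l (length L)))
  (partitionOf-betaSet L)

betaSet-partitionOf : ∀ {A} → Linked _>_ A → betaSet (partitionOf A) ≡ A
betaSet-partitionOf {[]}    _     = refl
betaSet-partitionOf {a ∷ A} a∷A↘ = cong₂ _∷_
  (trans (cong (_+_ (a ∸ length A)) (length-partitionOf A))
         (m∸n+n≡m (lowerBound+length≤head a∷A↘ (All.universal (λ _ → z≤n) (a ∷ A)))))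
  (betaSet-partitionOf (Linked.tail a∷A↘))

sum-betaSet : ∀ L → sum (betaSet L) ≡ sum L + triangular (length L)
sum-betaSet []      = refl
sum-betaSet (l ∷ L) = begin
  (l + length L) + sum (betaSet L)
    ≡⟨ cong (_+_ (l + length L)) (sum-betaSet L) ⟩
  (l + length L) + (sum L + triangular (length L))
    ≡⟨ +-interchange l (length L) (sum L) (triangular (length L)) ⟩
  (l + sum L) + (length L + triangular (length L))
    ∎
  where open ≡-Reasoning

betaSet-decreasing : ∀ {L} → IsPartition L → Linked _>_ (betaSet L) × All (0 <_) (betaSet L)
betaSet-decreasing {[]}          _                        = [] , []
betaSet-decreasing {l ∷ []}      (_ , 0<l ∷ [])           = [-] , m≤n⇒m≤n+o 0 0<l ∷ []
betaSet-decreasing {l ∷ l′ ∷ L}  (l′≤l ∷ L↘ , 0<l ∷ L-pos) with betaSet-decreasing (L↘ , L-pos)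
... | β↘ , β-pos = head-> ∷ β↘ , m≤n⇒m≤n+o (suc (length L)) 0<l ∷ β-pos
  where
  head-> : l′ + length L < l + suc (length L)
  head-> = ≤-trans (s≤s (+-monoˡ-≤ (length L) l′≤l)) (≤-reflexive (sym (+-suc l (length L))))

partitionOf-IsPartition : ∀ {A} → Linked _>_ A → All (0 <_) A → IsPartition (partitionOf A)
partitionOf-IsPartition {[]}         _              _               = [] , []
partitionOf-IsPartition {a ∷ []}     _              (0<a ∷ [])      = [-] , 0<a ∷ []
partitionOf-IsPartition {a ∷ a′ ∷ A} a∷a′∷A↘@(a′<a ∷ a′∷A↘) A-pos@(_ ∷ a′∷A-pos)
  with partitionOf-IsPartition a′∷A↘ a′∷A-pos
... | α↘ , α-pos = ∸-monoˡ-≤ (suc (length A)) a′<a ∷ α↘ , m<n⇒0<n∸m length<a ∷ α-pos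
  where
  length<a : suc (length A) < a
  length<a = lowerBound+length≤head a∷a′∷A↘ A-pos

rank-diagonal : ∀ {A} → Linked _>_ A → rank (A , A) ≡ + (2 * sum (partitionOf A))
rank-diagonal {A} A↘ = sum≡⇒rank≡ {A} {A} (begin
  sum A + sum A
    ≡⟨ cong (λ X → sum X + sum X) (betaSet-partitionOf A↘) ⟨
  sum (betaSet α) + sum (betaSet α)
    ≡⟨ cong (λ s → s + s) (sum-betaSet α) ⟩
  (sum α + t) + (sum α + t)
    ≡⟨ regroup (sum α) t ⟩
  (t + t) + 2 * sum α
    ≡⟨ cong (_+ 2 * sum α) (rankOffset-double (length α)) ⟨
  rankOffset (length α + length α) + 2 * sum α
    ≡⟨ cong (λ p → rankOffset (p + p) + 2 * sum α) (length-partitionOf A) ⟩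
  rankOffset (length A + length A) + 2 * sum α
    ∎)
  where
  open ≡-Reasoning
  α = partitionOf A
  t = triangular (length α)
  regroup : ∀ s t → (s + t) + (s + t) ≡ (t + t) + 2 * s
  regroup = ℕ-Solver.solve-∀

diagonal-IsPartitionOfHalf : ∀ {n A} → IsSymbol (A , A) → Reduced (A , A) → rank (A , A) ≡ + n →
                             IsPartitionOfHalf n (partitionOf A)
diagonal-IsPartitionOfHalf (A↘ , _) reduced rank≡n =
  partitionOf-IsPartition A↘ (Sum.[ id , id ] reduced) ,
  ℤ.+-injective (trans (sym (rank-diagonal A↘)) rank≡n)

IsPartitionOfHalf⇒diagonal : ∀ {n L} → IsPartitionOfHalf n L →
                             IsSymbol (betaSet L , betaSet L) × Reduced (betaSet L , betaSet L) ×
                             rank (betaSet L , betaSet L) ≡ + n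
IsPartitionOfHalf⇒diagonal {n} {L} (L-partition , 2*sum≡n) with betaSet-decreasing L-partition
... | β↘ , β-pos = (β↘ , β↘) , inj₁ β-pos , (begin
  rank (betaSet L , betaSet L)                 ≡⟨ rank-diagonal β↘ ⟩
  + (2 * sum (partitionOf (betaSet L)))        ≡⟨ cong (λ α → + (2 * sum α)) (partitionOf-betaSet L) ⟩
  + (2 * sum L)                                ≡⟨ cong +_ 2*sum≡n ⟩
  + n                                          ∎)
  where open ≡-Reasoning

partitionOf-injective : ∀ {A A′} → Linked _>_ A → Linked _>_ A′ →
                        partitionOf A ≡ partitionOf A′ → A ≡ A′
partitionOf-injective A↘ A′↘ eq =
  trans (sym (betaSet-partitionOf A↘)) (trans (cong betaSet eq) (betaSet-partitionOf A′↘))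

length-filter-∁-+-filter : ∀ {X : Set} {Q : X → Set} (Q? : Decidable Q) xs →
                           length (filter (∁? Q?) xs) + length (filter Q? xs) ≡ length xs
length-filter-∁-+-filter Q? []       = refl
length-filter-∁-+-filter Q? (x ∷ xs) with Q? x
... | yes _ = trans (+-suc _ _) (cong suc (length-filter-∁-+-filter Q? xs))
... | no  _ = cong suc (length-filter-∁-+-filter Q? xs)

PhiPlusReps : ℕ → List RawSymbol
PhiPlusReps n = filter (InPhiPlus? n) (candidates n)

module _ (n : ℕ) {Q : RawSymbol → Set} (Q? : Decidable Q) where

  ∈-filter-PhiPlusReps⁻ : ∀ {Λ} → Λ ∈ filter Q? (PhiPlusReps n) →
                          (IsSymbol Λ × Reduced Λ × InPhiPlus n Λ) × Q Λ
  ∈-filter-PhiPlusReps⁻ Λ∈ with ∈-filter⁻ Q? {xs = PhiPlusReps n} Λ∈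
  ... | Λ∈′ , q with ∈-filter⁻ (InPhiPlus? n) {xs = candidates n} Λ∈′
  ...   | Λ∈″ , Λ∈Φ⁺ with ∈-candidates⁻ {n} Λ∈″
  ...     | Λ-sym , reduced = (Λ-sym , reduced , Λ∈Φ⁺) , q

  ∈-filter-PhiPlusReps⁺ : ∀ {Λ} → IsSymbol Λ → Reduced Λ → InPhiPlus n Λ → Q Λ →
                          Λ ∈ filter Q? (PhiPlusReps n)
  ∈-filter-PhiPlusReps⁺ Λ-sym reduced Λ∈Φ⁺ q =
    ∈-filter⁺ Q? (∈-filter⁺ (InPhiPlus? n) (∈-candidates⁺ Λ-sym reduced (proj₁ Λ∈Φ⁺)) Λ∈Φ⁺) q

  filter-PhiPlusReps-Unique : Unique (filter Q? (PhiPlusReps n))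
  filter-PhiPlusReps-Unique = Unique.filter⁺ Q? (Unique.filter⁺ (InPhiPlus? n) (candidates-Unique n))

  filter-PhiPlusReps-IsSymbol : All IsSymbol (filter Q? (PhiPlusReps n))
  filter-PhiPlusReps-IsSymbol = All.tabulate (proj₁ ∘ proj₁ ∘ ∈-filter-PhiPlusReps⁻)

PhiMinusReps : ℕ → List RawSymbol
PhiMinusReps n = map (uncurry moveTop) (filter (∁? Diagonal?) (PhiPlusReps n))

halfPartitions : ℕ → List (List ℕ)
halfPartitions n = map (partitionOf ∘ proj₁) (filter Diagonal? (PhiPlusReps n))

PhiPlusReps-enumerates : ∀ n → EnumeratesClasses (InPhiPlus n) (PhiPlusReps n)
PhiPlusReps-enumerates n = filter-candidates-enumeratesClasses (InPhiPlus? n) proj₁ InPhiPlus-∼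

PhiMinusReps-enumerates : ∀ n → EnumeratesClasses (InPhiMinus n) (PhiMinusReps n)
PhiMinusReps-enumerates n = reduced-enumeratesClasses InPhiMinus-∼ (All.map⁺ (All.tabulate valid))
  (AllPairs.map⁺ (AllPairs-mapWith-All
    (λ Λ-sym Λ′-sym Λ≢Λ′ → Λ≢Λ′ ∘ moveTop-injective Λ-sym Λ′-sym)
    (filter-PhiPlusReps-IsSymbol n (∁? Diagonal?))
    (filter-PhiPlusReps-Unique n (∁? Diagonal?))))
  complete
  where
  valid : ∀ {Λ} → Λ ∈ filter (∁? Diagonal?) (PhiPlusReps n) →
          let Λ′ = uncurry moveTop Λ in IsSymbol Λ′ × Reduced Λ′ × InPhiMinus n Λ′
  valid {A , B} Λ∈ with ∈-filter-PhiPlusReps⁻ n (∁? Diagonal?) Λ∈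
  ... | (Λ-sym , reduced , Λ∈Φ⁺) , A≢B =
    moveTop-IsSymbol Λ-sym , moveTop-Reduced Λ-sym reduced , moveTop-InPhiPlus {n} {A} {B} A≢B Λ∈Φ⁺
  complete : ∀ {Λ} → IsSymbol Λ → Reduced Λ → InPhiMinus n Λ → Λ ∈ PhiMinusReps n
  complete {A , B} Λ-sym reduced Λ∈Φ⁻ = subst (_∈ PhiMinusReps n) (moveTop-involutive Λ-sym)
    (∈-map⁺ (uncurry moveTop) (∈-filter-PhiPlusReps⁺ n (∁? Diagonal?)
      (moveTop-IsSymbol Λ-sym) (moveTop-Reduced Λ-sym reduced) (moveTop-InPhiMinus {n} {A} {B} Λ∈Φ⁻)
      (moveTop-offDiagonal Λ-sym (InPhiMinus⇒≢ {n} {A} {B} Λ∈Φ⁻))))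

halfPartitions-enumerate : ∀ n → Enumerates (IsPartitionOfHalf n) (halfPartitions n)
halfPartitions-enumerate n =
  All.map⁺ (All.tabulate valid) ,
  AllPairs.map⁺ (AllPairs-mapWith-All
    (λ { (A↘ , refl) (A′↘ , refl) Λ≢Λ′ →
           Λ≢Λ′ ∘ cong (λ X → X , X) ∘ partitionOf-injective A↘ A′↘ })
    (All.tabulate decreasing-diagonal) (filter-PhiPlusReps-Unique n Diagonal?)) ,
  complete
  where
  F = filter Diagonal? (PhiPlusReps n)
  decreasing-diagonal : ∀ {Λ} → Λ ∈ F → Linked _>_ (proj₁ Λ) × Diagonal Λ
  decreasing-diagonal Λ∈ with ∈-filter-PhiPlusReps⁻ n Diagonal? Λ∈
  ... | ((A↘ , _) , _) , A≡B = A↘ , A≡B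
  valid : ∀ {Λ} → Λ ∈ F → IsPartitionOfHalf n (partitionOf (proj₁ Λ))
  valid Λ∈ with ∈-filter-PhiPlusReps⁻ n Diagonal? Λ∈
  ... | (Λ-sym , reduced , rank≡n , _) , refl = diagonal-IsPartitionOfHalf Λ-sym reduced rank≡n
  complete : ∀ L → IsPartitionOfHalf n L → L ∈ halfPartitions n
  complete L L-half with IsPartitionOfHalf⇒diagonal L-half
  ... | β-sym , reduced , rank≡n = subst (_∈ halfPartitions n) (partitionOf-betaSet L)
    (∈-map⁺ (partitionOf ∘ proj₁)
      (∈-filter-PhiPlusReps⁺ n Diagonal? β-sym reduced (diagonal-InPhiPlus {A = betaSet L} rank≡n) refl))

corollary3p5 : (n : ℕ) →
  Σ (List RawSymbol) (λ Lplus → Σ (List RawSymbol) (λ Lminus → Σ (List (List ℕ)) (λ Lp →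
    EnumeratesClasses (InPhiPlus n) Lplus ×
    EnumeratesClasses (InPhiMinus n) Lminus ×
    Enumerates (IsPartitionOfHalf n) Lp ×
    (+ length Lplus - + length Lminus ≡ + length Lp))))
corollary3p5 n =
  PhiPlusReps n , PhiMinusReps n , halfPartitions n ,
  PhiPlusReps-enumerates n , PhiMinusReps-enumerates n , halfPartitions-enumerate n , (begin
    + length (PhiPlusReps n) - + length (PhiMinusReps n)
      ≡⟨ cong₂ (λ p m → + p - + m) (sym (length-filter-∁-+-filter Diagonal? (PhiPlusReps n)))
                                    (length-map (uncurry moveTop) offDiagonal) ⟩
    + (length offDiagonal + length diagonal) - + length offDiagonal
      ≡⟨ +[m+n]-+m≡+n (length offDiagonal) (length diagonal) ⟩
    + length diagonal
      ≡⟨ cong +_ (length-map (partitionOf ∘ proj₁) diagonal) ⟨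
    + length (halfPartitions n)
      ∎)
  where
  open ≡-Reasoning
  offDiagonal = filter (∁? Diagonal?) (PhiPlusReps n)
  diagonal    = filter Diagonal? (PhiPlusReps n)
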